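{- Let $r\geq 1$ be an integer and let $G=(V,E)$ be a bi-critical, non-bipartite $r$-graph such that there is no odd set $X\subseteq V$ with $|X|\neq 1$, $|X|\neq |V|-1$ and $|\partial(X)|=r$. Then $G$ is a brick.
   Context: All graphs are finite and connected; multiple edges are allowed but loops are not. For $X\subseteq V$, $\partial(X)$ denotes the set of edges of $G$ with exactly one end in $X$. A set $X$ is odd if $|X|$ is odd. An $r$-graph is an $r$-regular graph $G=(V,E)$ such that $|\partial(X)|\geq r$ for every odd set $X\subseteq V$. A graph $G$ is bi-critical if $G-u-v$ has a perfect matching for every pair of distinct vertices $u,v$ of $G$. A brick is a graph that is non-bipartite, bi-critical and $3$-vertex-connected. -}

module Defs where

open import Data.Nat using (ℕ; _<_; _≥_; _%_; _∸_)
open import Data.Fin using (Fin; _≟_)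
open import Data.Fin.Subset using (Subset; ∣_∣; _∩_; _∈_; _∉_; ⁅_⁆)
open import Data.Bool using (Bool; _xor_; _∨_)
open import Data.Vec using (tabulate; lookup)
open import Data.Product using (Σ; ∃; _×_; _,_)
open import Data.Sum using (_⊎_)
open import Data.Unit using (⊤)
open import Relation.Nullary using (¬_)
open import Relation.Nullary.Decidable using (⌊_⌋)
open import Relation.Binary.PropositionalEquality using (_≡_; _≢_)

-- A finite loopless multigraph: vertices Fin nV, edges Fin nE,
-- edge e joins src e and tgt e (the orientation is irrelevant).
record Graph : Set where
  field
    nV nE    : ℕ
    src tgt  : Fin nE → Fin nV
    loopless : ∀ e → src e ≢ tgt e

module _ (G : Graph) where
  open Graph G

  Adj : Fin nV → Fin nV → Set
  Adj u w = ∃ λ e → (src e ≡ u × tgt e ≡ w) ⊎ (src e ≡ w × tgt e ≡ u)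

  data WalkIn (A : Fin nV → Set) : Fin nV → Fin nV → Set where
    nil  : ∀ {u} → A u → WalkIn A u u
    cons : ∀ {u w v} → A u → Adj u w → WalkIn A w v → WalkIn A u v

  Connected : Set
  Connected = ∀ u v → WalkIn (λ _ → ⊤) u v

  ConnectedWithout : Subset nV → Set
  ConnectedWithout S = ∀ u v → u ∉ S → v ∉ S → WalkIn (λ w → w ∉ S) u v

  inc : Fin nV → Subset nE
  inc v = tabulate (λ e → ⌊ src e ≟ v ⌋ ∨ ⌊ tgt e ≟ v ⌋)

  degree : Fin nV → ℕ
  degree v = ∣ inc v ∣

  Regular : ℕ → Set
  Regular r = ∀ v → degree v ≡ r

  ∂ : Subset nV → Subset nE
  ∂ X = tabulate (λ e → lookup X (src e) xor lookup X (tgt e))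

  OddSet : Subset nV → Set
  OddSet X = ∣ X ∣ % 2 ≡ 1

  IsRGraph : ℕ → Set
  IsRGraph r = Regular r × (∀ X → OddSet X → ∣ ∂ X ∣ ≥ r)

  PerfectMatchingWithout : Subset nV → Subset nE → Set
  PerfectMatchingWithout D M =
    (∀ e → e ∈ M → src e ∉ D × tgt e ∉ D) ×
    (∀ w → w ∉ D → ∣ M ∩ inc w ∣ ≡ 1)

  BiCritical : Set
  BiCritical = ∀ u v → u ≢ v →
    ∃ λ M → PerfectMatchingWithout (⁅ u ⁆ Data.Fin.Subset.∪ ⁅ v ⁆) M

  Bipartite : Set
  Bipartite = ∃ λ (c : Fin nV → Bool) → ∀ e → c (src e) ≢ c (tgt e)

  VertexConnected : ℕ → Set
  VertexConnected k = k < nV × (∀ S → ∣ S ∣ < k → ConnectedWithout S)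

  Brick : Set
  Brick = ¬ Bipartite × BiCritical × VertexConnected 3

-- For a ≠ b, G − a − b has a perfect matching M, and M matches every union C of components
-- of G − a − b inside itself; so |C| is even and C ∪ {a}, C ∪ {b} are odd. Counting edge
-- by edge, |∂(C ∪ {a})| + |∂(C ∪ {b})| = d(a) + d(b) = 2r, and both cuts have size at least r, so
-- ∂(C ∪ {a}) is a tight cut. It is non-trivial when C ≠ ∅ and a vertex lies outside C ∪ {a, b},
-- hence no two vertices separate G. Once |V| ≥ 4, a separating set of at most two vertices can be
-- enlarged to exactly two; and |V| ≥ 4 because graphs on at most two vertices are bipartite, while
-- bicriticality makes |V| even.
module Submission where

open import Data.Bool using (Bool; true; false; T; not; _∧_; _∨_; _xor_)
open import Data.Bool.Properties using (∧-zeroʳ; ∧-identityʳ; ∧-distribˡ-∨; T-≡; T-not-≡; T-∨; T-∧)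
open import Data.Empty using (⊥; ⊥-elim)
open import Data.Fin using (Fin; zero; suc)
open import Data.Fin.Properties using (_≟_; any?)
open import Data.Fin.Subset using (Subset; ∣_∣; _∈_; _∉_; _∩_; _∪_; ⁅_⁆)
open import Data.Fin.Subset.Properties using (_∈?_; x∈p∪q⁻; x∈p∪q⁺; x∈⁅x⁆; x∈⁅y⁆⇒x≡y)
open import Data.Nat using (ℕ; zero; suc; _+_; _*_; _∸_; _%_; _≤_; _<_; _≥_; z≤n; s≤s; _≤?_)
open import Data.Nat.DivMod using ([m+kn]%n≡m%n)
open import Data.Nat.Properties
  using ( +-0-commutativeMonoid; +-comm; +-suc; +-identityʳ; *-comm; suc-injective
        ; ≤-refl; ≤-reflexive; ≤-trans; ≤-antisym; <-irrefl; <⇒≱; ≰⇒>; 1+n≰n; m≤m+n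
        ; +-mono-≤; +-monoʳ-≤; +-cancelʳ-≤; module ≤-Reasoning)
open import Algebra.Properties.CommutativeMonoid.Sum +-0-commutativeMonoid
  using (sum; sum-syntax; sum-cong-≗; ∑-distrib-+; ∑-comm; sum-replicate-zero)
open import Data.Product using (∃; ∃₂; _×_; _,_; proj₁; proj₂)
open import Data.Sum as Sum using (_⊎_; inj₁; inj₂)
open import Data.Unit using (tt)
open import Data.Vec using (tabulate; lookup)
open import Data.Vec.Properties using (tabulate∘lookup; lookup∘tabulate; lookup-zipWith; []=⇒lookup; lookup⇒[]=)
open import Function using (_∘_; id)
open import Function.Bundles using (Equivalence)
open import Relation.Nullary using (¬_; Dec; yes; no)
open import Relation.Nullary.Decidable using (does; dec-true; dec-false; _×-dec_; _⊎-dec_; ¬?; T?; isYes≗does)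
open import Relation.Binary.PropositionalEquality

open import Defs

suc-double%2 : ∀ k → suc (k + k) % 2 ≡ 1
suc-double%2 k = begin
  suc (k + k) % 2    ≡⟨ cong (λ m → suc m % 2) (trans (cong (k +_) (sym (+-identityʳ k))) (*-comm 2 k)) ⟩
  (1 + k * 2) % 2    ≡⟨ [m+kn]%n≡m%n 1 k 2 ⟩
  1                  ∎
  where open ≡-Reasoning

3≤2+2k⇒4≤ : ∀ k → 3 ≤ 2 + (k + k) → 4 ≤ 2 + (k + k)
3≤2+2k⇒4≤ zero    (s≤s (s≤s ()))
3≤2+2k⇒4≤ (suc k) _ = s≤s (s≤s (s≤s (subst (1 ≤_) (sym (+-suc k k)) (s≤s z≤n))))

pred+2≰ : ∀ n → ¬ (n ∸ 1) + 2 ≤ n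
pred+2≰ (suc n) le = 1+n≰n (subst (_≤ suc n) (+-comm n 2) le)

𝟙 : Bool → ℕ
𝟙 true  = 1
𝟙 false = 0

𝟙-∨ : ∀ a b → (T a → T b → ⊥) → 𝟙 (a ∨ b) ≡ 𝟙 a + 𝟙 b
𝟙-∨ true  true  disj = ⊥-elim (disj tt tt)
𝟙-∨ true  false _    = refl
𝟙-∨ false b     _    = refl

𝟙-∨-≤ : ∀ a b → 𝟙 (a ∨ b) ≤ 𝟙 a + 𝟙 b
𝟙-∨-≤ true  b = s≤s z≤n
𝟙-∨-≤ false b = ≤-refl

𝟙+𝟙-not : ∀ a → 𝟙 a + 𝟙 (not a) ≡ 1
𝟙+𝟙-not true  = refl
𝟙+𝟙-not false = refl

𝟙-split : ∀ a e → 𝟙 a ≡ 𝟙 (a ∧ not e) + 𝟙 (a ∧ e)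
𝟙-split true  true  = refl
𝟙-split true  false = refl
𝟙-split false e     = refl

¬T-not : ∀ {b} → T (not b) → ¬ T b
¬T-not {false} _ ()
¬T-not {true}  ()

¬T⇒T-not : ∀ {b} → ¬ T b → T (not b)
¬T⇒T-not {false} _  = _
¬T⇒T-not {true}  ¬t = ¬t _

¬T⇒≡false : ∀ {b} → ¬ T b → b ≡ false
¬T⇒≡false {false} _  = refl
¬T⇒≡false {true}  ¬t = ⊥-elim (¬t _)

T⇔T⇒≡ : ∀ {a b} → (T a → T b) → (T b → T a) → a ≡ b
T⇔T⇒≡ {true}  {true}  _   _   = refl
T⇔T⇒≡ {true}  {false} a⇒b _   = ⊥-elim (a⇒b _)
T⇔T⇒≡ {false} {true}  _   b⇒a = ⊥-elim (b⇒a _)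
T⇔T⇒≡ {false} {false} _   _   = refl

-- Defined with does rather than ⌊_⌋ so that suc x ≡ᵇ suc y reduces to x ≡ᵇ y.
_≡ᵇ_ : ∀ {n} → Fin n → Fin n → Bool
x ≡ᵇ y = does (x ≟ y)

≡ᵇ⇒≡ : ∀ {n} {x y : Fin n} → T (x ≡ᵇ y) → x ≡ y
≡ᵇ⇒≡ {x = x} {y} t with yes x≡y ← x ≟ y = x≡y

≡ᵇ-refl : ∀ {n} (x : Fin n) → T (x ≡ᵇ x)
≡ᵇ-refl x = Equivalence.from T-≡ (dec-true (x ≟ x) refl)

≡⇒≡ᵇ : ∀ {n} {x y : Fin n} → x ≡ y → T (x ≡ᵇ y)
≡⇒≡ᵇ {x = x} refl = ≡ᵇ-refl x

≢⇒≡ᵇ-false : ∀ {n} {x y : Fin n} → x ≢ y → (x ≡ᵇ y) ≡ false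
≢⇒≡ᵇ-false {x = x} {y} = dec-false (x ≟ y)

≡ᵇ-sym : ∀ {n} (x y : Fin n) → (x ≡ᵇ y) ≡ (y ≡ᵇ x)
≡ᵇ-sym x y with x ≟ y | y ≟ x
... | yes _   | yes _   = refl
... | no  _   | no  _   = refl
... | yes x≡y | no  y≢x = ⊥-elim (y≢x (sym x≡y))
... | no  x≢y | yes y≡x = ⊥-elim (x≢y (sym y≡x))

sum-mono-≤ : ∀ {n} {f g : Fin n → ℕ} → (∀ i → f i ≤ g i) → sum f ≤ sum g
sum-mono-≤ {zero}  f≤g = z≤n
sum-mono-≤ {suc n} f≤g = +-mono-≤ (f≤g zero) (sum-mono-≤ (f≤g ∘ suc))

count : ∀ {n} → (Fin n → Bool) → ℕ
count {n} f = ∑[ i < n ] 𝟙 (f i)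

count-cong : ∀ {n} {f g : Fin n → Bool} → (∀ i → f i ≡ g i) → count f ≡ count g
count-cong f≗g = sum-cong-≗ (cong 𝟙 ∘ f≗g)

count-∨ : ∀ {n} (f g : Fin n → Bool) → (∀ i → T (f i) → T (g i) → ⊥) →
          count (λ i → f i ∨ g i) ≡ count f + count g
count-∨ f g disj = trans (sum-cong-≗ (λ i → 𝟙-∨ (f i) (g i) (disj i))) (∑-distrib-+ (𝟙 ∘ f) (𝟙 ∘ g))

count-∨-≤ : ∀ {n} (f g : Fin n → Bool) → count (λ i → f i ∨ g i) ≤ count f + count g
count-∨-≤ f g = subst (count (λ i → f i ∨ g i) ≤_) (∑-distrib-+ (𝟙 ∘ f) (𝟙 ∘ g))
                      (sum-mono-≤ (λ i → 𝟙-∨-≤ (f i) (g i)))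

count-true : ∀ n → count {n} (λ _ → true) ≡ n
count-true zero    = refl
count-true (suc n) = cong suc (count-true n)

count-false : ∀ n → count {n} (λ _ → false) ≡ 0
count-false n = sum-replicate-zero n

count+count-not : ∀ {n} (f : Fin n → Bool) → count f + count (not ∘ f) ≡ n
count+count-not {n} f = begin
  count f + count (not ∘ f)          ≡⟨ ∑-distrib-+ (𝟙 ∘ f) (𝟙 ∘ not ∘ f) ⟨
  ∑[ i < n ] (𝟙 (f i) + 𝟙 (not (f i))) ≡⟨ sum-cong-≗ (𝟙+𝟙-not ∘ f) ⟩
  count {n} (λ _ → true)             ≡⟨ count-true n ⟩
  n                                  ∎
  where open ≡-Reasoning

count≤n : ∀ {n} (f : Fin n → Bool) → count f ≤ n
count≤n f = subst (count f ≤_) (count+count-not f) (m≤m+n (count f) _)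

count-witness : ∀ {n} (f : Fin n → Bool) → 0 < count f → ∃ λ i → T (f i)
count-witness {suc n} f pos with f zero in eq
... | true  = zero , subst T (sym eq) tt
... | false with i , fi ← count-witness (f ∘ suc) pos = suc i , fi

count<n⇒∃∉ : ∀ {n} (f : Fin n → Bool) → count f < n → ∃ λ i → ¬ T (f i)
count<n⇒∃∉ {n} f count<n with count (not ∘ f) in eq | count+count-not f
... | zero  | total = ⊥-elim (<-irrefl (trans (sym (+-identityʳ (count f))) total) count<n)
... | suc _ | _ with i , t ← count-witness (not ∘ f) (subst (0 <_) (sym eq) (s≤s z≤n)) = i , ¬T-not t

count-sift : ∀ {n} (f : Fin n → Bool) x → count (λ i → f i ∧ (i ≡ᵇ x)) ≡ 𝟙 (f x)
count-sift {suc n} f zero = begin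
  𝟙 (f zero ∧ true) + count (λ i → f (suc i) ∧ false)
    ≡⟨ cong₂ _+_ (cong 𝟙 (∧-identityʳ (f zero))) (count-cong (∧-zeroʳ ∘ f ∘ suc)) ⟩
  𝟙 (f zero) + count {n} (λ _ → false)                ≡⟨ cong (𝟙 (f zero) +_) (count-false n) ⟩
  𝟙 (f zero) + 0                                      ≡⟨ +-comm (𝟙 (f zero)) 0 ⟩
  𝟙 (f zero)                                          ∎
  where open ≡-Reasoning
count-sift {suc n} f (suc x) rewrite ∧-zeroʳ (f zero) = count-sift (f ∘ suc) x

count-single : ∀ {n} (x : Fin n) → count (_≡ᵇ x) ≡ 1
count-single x = count-sift (λ _ → true) x

count-pair : ∀ {n} (f : Fin n → Bool) {s t} → s ≢ t →
             count (λ i → f i ∧ ((s ≡ᵇ i) ∨ (t ≡ᵇ i))) ≡ 𝟙 (f s) + 𝟙 (f t)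
count-pair f {s} {t} s≢t = begin
  count (λ i → f i ∧ ((s ≡ᵇ i) ∨ (t ≡ᵇ i)))
    ≡⟨ count-cong (λ i → ∧-distribˡ-∨ (f i) (s ≡ᵇ i) (t ≡ᵇ i)) ⟩
  count (λ i → (f i ∧ (s ≡ᵇ i)) ∨ (f i ∧ (t ≡ᵇ i)))
    ≡⟨ count-∨ _ _ disjoint ⟩
  count (λ i → f i ∧ (s ≡ᵇ i)) + count (λ i → f i ∧ (t ≡ᵇ i))
    ≡⟨ cong₂ _+_ (sift s) (sift t) ⟩
  𝟙 (f s) + 𝟙 (f t)
    ∎
  where
  open ≡-Reasoning
  sift : ∀ x → count (λ i → f i ∧ (x ≡ᵇ i)) ≡ 𝟙 (f x)
  sift x = trans (count-cong (λ i → cong (f i ∧_) (≡ᵇ-sym x i))) (count-sift f x)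
  disjoint : ∀ i → T (f i ∧ (s ≡ᵇ i)) → T (f i ∧ (t ≡ᵇ i)) → ⊥
  disjoint i p q = s≢t (trans (≡ᵇ⇒≡ (proj₂ (Equivalence.to T-∧ p)))
                              (sym (≡ᵇ⇒≡ (proj₂ (Equivalence.to T-∧ q)))))

insert : ∀ {n} → (Fin n → Bool) → Fin n → (Fin n → Bool)
insert f y i = f i ∨ (i ≡ᵇ y)

count-insert : ∀ {n} (f : Fin n → Bool) {y} → ¬ T (f y) → count (insert f y) ≡ suc (count f)
count-insert f {y} y∉f = begin
  count (insert f y)          ≡⟨ count-∨ f (_≡ᵇ y) (λ i fi i≡y → y∉f (subst (T ∘ f) (≡ᵇ⇒≡ i≡y) fi)) ⟩
  count f + count (_≡ᵇ y)     ≡⟨ cong (count f +_) (count-single y) ⟩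
  count f + 1                 ≡⟨ +-comm (count f) 1 ⟩
  suc (count f)               ∎
  where open ≡-Reasoning

∉-insert : ∀ {n} (f : Fin n → Bool) {x y} → ¬ T (f x) → x ≢ y → T (not (insert f y x))
∉-insert f x∉f x≢y = Equivalence.from T-not-≡ (cong₂ _∨_ (¬T⇒≡false x∉f) (≢⇒≡ᵇ-false x≢y))

_∖_ : ∀ {n} → (Fin n → Bool) → Fin n → (Fin n → Bool)
(f ∖ x) i = f i ∧ not (i ≡ᵇ x)

∈-∖ : ∀ {n} (f : Fin n → Bool) {x y} → T (f y) → y ≢ x → T ((f ∖ x) y)
∈-∖ f fy y≢x rewrite ≢⇒≡ᵇ-false y≢x = Equivalence.from T-∧ (fy , _)

∖-⊆ : ∀ {n} (f : Fin n → Bool) {x y} → T ((f ∖ x) y) → T (f y)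
∖-⊆ f = proj₁ ∘ Equivalence.to T-∧

∉-∖ : ∀ {n} (f : Fin n → Bool) x → ¬ T ((f ∖ x) x)
∉-∖ f x t = ¬T-not (proj₂ (Equivalence.to T-∧ t)) (≡ᵇ-refl x)

count-remove : ∀ {n} (f : Fin n → Bool) {x} → T (f x) → count f ≡ suc (count (f ∖ x))
count-remove {n} f {x} fx = begin
  count f                                          ≡⟨ sum-cong-≗ (λ i → 𝟙-split (f i) (i ≡ᵇ x)) ⟩
  ∑[ i < n ] (𝟙 ((f ∖ x) i) + 𝟙 (f i ∧ (i ≡ᵇ x)))  ≡⟨ ∑-distrib-+ (𝟙 ∘ (f ∖ x)) _ ⟩
  count (f ∖ x) + count (λ i → f i ∧ (i ≡ᵇ x))     ≡⟨ cong (count (f ∖ x) +_) (count-sift f x) ⟩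
  count (f ∖ x) + 𝟙 (f x)                          ≡⟨ cong (λ b → count (f ∖ x) + 𝟙 b) (Equivalence.to T-≡ fx) ⟩
  count (f ∖ x) + 1                                ≡⟨ +-comm (count (f ∖ x)) 1 ⟩
  suc (count (f ∖ x))                              ∎
  where open ≡-Reasoning

1≤count : ∀ {n} (f : Fin n → Bool) {x} → T (f x) → 1 ≤ count f
1≤count f fx rewrite count-remove f fx = s≤s z≤n

2≤count : ∀ {n} (f : Fin n → Bool) {x y} → T (f x) → T (f y) → x ≢ y → 2 ≤ count f
2≤count f {x} fx fy x≢y rewrite count-remove f fx = s≤s (1≤count (f ∖ x) (∈-∖ f fy (x≢y ∘ sym)))

3≤count : ∀ {n} (f : Fin n → Bool) {x y z} → T (f x) → T (f y) → T (f z) →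
          x ≢ y → x ≢ z → y ≢ z → 3 ≤ count f
3≤count f {x} fx fy fz x≢y x≢z y≢z rewrite count-remove f fx =
  s≤s (2≤count (f ∖ x) (∈-∖ f fy (x≢y ∘ sym)) (∈-∖ f fz (x≢z ∘ sym)) y≢z)

∣tabulate∣≡count : ∀ {n} (f : Fin n → Bool) → ∣ tabulate f ∣ ≡ count f
∣tabulate∣≡count {zero}  f = refl
∣tabulate∣≡count {suc n} f with f zero
... | true  = cong suc (∣tabulate∣≡count (f ∘ suc))
... | false = ∣tabulate∣≡count (f ∘ suc)

∣p∣≡count : ∀ {n} (p : Subset n) → ∣ p ∣ ≡ count (lookup p)
∣p∣≡count p = trans (cong ∣_∣ (sym (tabulate∘lookup p))) (∣tabulate∣≡count (lookup p))

∈⇒T : ∀ {n} {x : Fin n} {p : Subset n} → x ∈ p → T (lookup p x)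
∈⇒T x∈p = Equivalence.from T-≡ ([]=⇒lookup x∈p)

T⇒∈ : ∀ {n} {x : Fin n} {p : Subset n} → T (lookup p x) → x ∈ p
T⇒∈ {x = x} {p} t = lookup⇒[]= x p (Equivalence.to T-≡ t)

two-distinct : ∀ {n} → 2 ≤ n → ∃₂ λ (x y : Fin n) → x ≢ y
two-distinct (s≤s (s≤s _)) = zero , suc zero , λ ()

isZero : ∀ {n} → Fin n → Bool
isZero zero    = true
isZero (suc _) = false

isZero-separates : ∀ {n} → n ≤ 2 → {x y : Fin n} → x ≢ y → isZero x ≢ isZero y
isZero-separates _                 {zero}     {zero}     x≢y _  = x≢y refl
isZero-separates _                 {zero}     {suc _}    _   ()
isZero-separates _                 {suc _}    {zero}     _   ()
isZero-separates (s≤s (s≤s z≤n))   {suc zero} {suc zero} x≢y _  = x≢y refl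

avoid-three : ∀ {n} → 4 ≤ n → (x y z : Fin n) → ∃ λ w → w ≢ x × w ≢ y × w ≢ z
avoid-three {n} 4≤n x y z =
  w , (λ w≡x → w∉ (∨-inj₁ (≡⇒≡ᵇ w≡x)))
    , (λ w≡y → w∉ (∨-inj₂ {w ≡ᵇ x} (∨-inj₁ (≡⇒≡ᵇ w≡y))))
    , (λ w≡z → w∉ (∨-inj₂ {w ≡ᵇ x} (∨-inj₂ {w ≡ᵇ y} (≡⇒≡ᵇ w≡z))))
  where
  xyz : Fin n → Bool
  xyz i = (i ≡ᵇ x) ∨ (i ≡ᵇ y) ∨ (i ≡ᵇ z)
  ∨-inj₁ : ∀ {a b} → T a → T (a ∨ b)
  ∨-inj₁ = Equivalence.from T-∨ ∘ inj₁
  ∨-inj₂ : ∀ {a b} → T b → T (a ∨ b)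
  ∨-inj₂ = Equivalence.from T-∨ ∘ inj₂
  count≤3 : count xyz ≤ 3
  count≤3 = begin
    count xyz
      ≤⟨ count-∨-≤ (_≡ᵇ x) _ ⟩
    count (_≡ᵇ x) + count (λ i → (i ≡ᵇ y) ∨ (i ≡ᵇ z))
      ≤⟨ +-monoʳ-≤ (count (_≡ᵇ x)) (count-∨-≤ (_≡ᵇ y) (_≡ᵇ z)) ⟩
    count (_≡ᵇ x) + (count (_≡ᵇ y) + count (_≡ᵇ z))
      ≡⟨ cong₂ _+_ (count-single x) (cong₂ _+_ (count-single y) (count-single z)) ⟩
    3 ∎
    where open ≤-Reasoning
  w∉xyz : ∃ λ w → ¬ T (xyz w)
  w∉xyz = count<n⇒∃∉ xyz (≤-trans (s≤s count≤3) 4≤n)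
  w : Fin n
  w = proj₁ w∉xyz
  w∉ : ¬ T (xyz w)
  w∉ = proj₂ w∉xyz

OneOf : ∀ {n} → Fin n → Fin n → Fin n → Set
OneOf a b x = x ≡ a ⊎ x ≡ b

¬OneOf : ∀ {n} {a b x : Fin n} → x ≢ a → x ≢ b → ¬ OneOf a b x
¬OneOf x≢a x≢b (inj₁ x≡a) = x≢a x≡a
¬OneOf x≢a x≢b (inj₂ x≡b) = x≢b x≡b

∈⁅⁆∪⁅⁆⇒OneOf : ∀ {n} {a b x : Fin n} → x ∈ ⁅ a ⁆ ∪ ⁅ b ⁆ → OneOf a b x
∈⁅⁆∪⁅⁆⇒OneOf {a = a} {b} = Sum.map (x∈⁅y⁆⇒x≡y a) (x∈⁅y⁆⇒x≡y b) ∘ x∈p∪q⁻ ⁅ a ⁆ ⁅ b ⁆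

OneOf⇒∈⁅⁆∪⁅⁆ : ∀ {n} {a b x : Fin n} → OneOf a b x → x ∈ ⁅ a ⁆ ∪ ⁅ b ⁆
OneOf⇒∈⁅⁆∪⁅⁆ (inj₁ refl) = x∈p∪q⁺ (inj₁ (x∈⁅x⁆ _))
OneOf⇒∈⁅⁆∪⁅⁆ (inj₂ refl) = x∈p∪q⁺ (inj₂ (x∈⁅x⁆ _))

T-insert⇒OneOf : ∀ {n} {a b x : Fin n} → T (insert (_≡ᵇ a) b x) → OneOf a b x
T-insert⇒OneOf {x = x} = Sum.map (≡ᵇ⇒≡ {x = x}) (≡ᵇ⇒≡ {x = x}) ∘ Equivalence.to T-∨

OneOf⇒T-insert : ∀ {n} {a b x : Fin n} → OneOf a b x → T (insert (_≡ᵇ a) b x)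
OneOf⇒T-insert = Equivalence.from T-∨ ∘ Sum.map ≡⇒≡ᵇ ≡⇒≡ᵇ

∈∧∉⇒≢ : ∀ {n} {S : Subset n} {x y} → x ∈ S → y ∉ S → y ≢ x
∈∧∉⇒≢ {S = S} x∈S y∉S y≡x = y∉S (subst (_∈ S) (sym y≡x) x∈S)

-- Lets a separation by at most two vertices be treated as one by exactly two.
pair-cover : ∀ {n} → 4 ≤ n → (S : Subset n) → ∣ S ∣ < 3 → ∀ {u v} → u ∉ S → v ∉ S →
             ∃₂ λ a b → a ≢ b × (∀ x → x ∈ S → OneOf a b x) × ¬ OneOf a b u × ¬ OneOf a b v
pair-cover 4≤n S ∣S∣<3 {u} {v} u∉S v∉S with any? (_∈? S)
... | no S-empty with avoid-three 4≤n u v u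
... | a , a≢u , a≢v , _ with avoid-three 4≤n u v a
... | b , b≢u , b≢v , b≢a =
  a , b , ≢-sym b≢a , (λ x x∈S → ⊥-elim (S-empty (x , x∈S))) ,
  ¬OneOf (≢-sym a≢u) (≢-sym b≢u) , ¬OneOf (≢-sym a≢v) (≢-sym b≢v)
pair-cover 4≤n S ∣S∣<3 {u} {v} u∉S v∉S | yes (a , a∈S)
  with any? (λ b → (b ∈? S) ×-dec ¬? (b ≟ a))
... | yes (b , b∈S , b≢a) =
  a , b , ≢-sym b≢a , cover ,
  ¬OneOf (∈∧∉⇒≢ a∈S u∉S) (∈∧∉⇒≢ b∈S u∉S) ,
  ¬OneOf (∈∧∉⇒≢ a∈S v∉S) (∈∧∉⇒≢ b∈S v∉S)
  where
  cover : ∀ x → x ∈ S → OneOf a b x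
  cover x x∈S with x ≟ a | x ≟ b
  ... | yes x≡a | _       = inj₁ x≡a
  ... | no _    | yes x≡b = inj₂ x≡b
  ... | no x≢a  | no x≢b  = ⊥-elim (<⇒≱ ∣S∣<3 (subst (3 ≤_) (sym (∣p∣≡count S))
          (3≤count (lookup S) (∈⇒T a∈S) (∈⇒T b∈S) (∈⇒T x∈S) (≢-sym b≢a) (≢-sym x≢a) (≢-sym x≢b))))
... | no no-second with b , b≢u , b≢v , b≢a ← avoid-three 4≤n u v a =
  a , b , ≢-sym b≢a , cover ,
  ¬OneOf (∈∧∉⇒≢ a∈S u∉S) (≢-sym b≢u) , ¬OneOf (∈∧∉⇒≢ a∈S v∉S) (≢-sym b≢v)
  where
  cover : ∀ x → x ∈ S → OneOf a b x
  cover x x∈S with x ≟ a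
  ... | yes x≡a = inj₁ x≡a
  ... | no x≢a  = ⊥-elim (no-second (x , x∈S , x≢a))

module _ {n} {R : Fin n → Fin n → Set} (R? : ∀ x y → Dec (R x y)) where

  Closed : (Fin n → Bool) → Set
  Closed C = ∀ {x y} → T (C x) → R x y → T (C y)

  closure : (P : Fin n → Set) → (∀ {x y} → P x → R x y → P y) →
            (C : Fin n → Bool) → (∀ {x} → T (C x) → P x) →
            ∃ λ C′ → (∀ {x} → T (C x) → T (C′ x)) × (∀ {x} → T (C′ x) → P x) × Closed C′
  closure P P-closed C C⊆P = grow n C (m≤m+n n (count C)) C⊆P
    where
    -- k bounds the number of elements still missing from C; each step adds one.
    grow : ∀ k C → n ≤ k + count C → (∀ {x} → T (C x) → P x) →
           ∃ λ C′ → (∀ {x} → T (C x) → T (C′ x)) × (∀ {x} → T (C′ x) → P x) × Closed C′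
    grow k C bound C⊆P with any? (λ y → ¬? (T? (C y)) ×-dec any? (λ x → T? (C x) ×-dec R? x y))
    ... | no stuck = C , id , C⊆P , closed
      where
      closed : Closed C
      closed {x} {y} Cx Rxy with T? (C y)
      ... | yes Cy = Cy
      ... | no ¬Cy = ⊥-elim (stuck (y , ¬Cy , x , Cx , Rxy))
    ... | yes (y , ¬Cy , x , Cx , Rxy) with k
    ...   | zero = ⊥-elim (1+n≰n (≤-trans (subst (_≤ n) (count-insert C ¬Cy) (count≤n _)) bound))
    ...   | suc k′ with grow k′ (insert C y) bound′ insert⊆P
      where
      bound′ : n ≤ k′ + count (insert C y)
      bound′ = subst (n ≤_) (trans (sym (+-suc k′ (count C))) (cong (k′ +_) (sym (count-insert C ¬Cy)))) bound
      insert⊆P : ∀ {i} → T (insert C y i) → P i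
      insert⊆P t with Equivalence.to T-∨ t
      ... | inj₁ Ci  = C⊆P Ci
      ... | inj₂ i≡y = subst P (sym (≡ᵇ⇒≡ i≡y)) (P-closed (C⊆P Cx) Rxy)
    ...     | C′ , insert⊆C′ , C′⊆P , closed =
      C′ , (λ Cx → insert⊆C′ (Equivalence.from T-∨ (inj₁ Cx))) , C′⊆P , closed

-- The position of a vertex relative to a set C and two vertices a, b ∉ C;
-- isC s ∨ isA s is membership in C ∪ {a}, and isC s ∨ isB s in C ∪ {b}.
data Side : Set where
  shore atA atB far : Side

isC isA isB : Side → Bool
isC shore = true
isC _     = false
isA atA   = true
isA _     = false
isB atB   = true
isB _     = false

classify : (atA? atB? inC? : Bool) → Side
classify true  _     _     = atA
classify false true  _     = atB
classify false false true  = shore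
classify false false false = far

isA-classify : ∀ p q c → isA (classify p q c) ≡ p
isA-classify true  _     _     = refl
isA-classify false true  _     = refl
isA-classify false false true  = refl
isA-classify false false false = refl

isB-classify : ∀ p q c → (T p → ¬ T q) → isB (classify p q c) ≡ q
isB-classify true  true  _     p⇒¬q = ⊥-elim (p⇒¬q _ _)
isB-classify true  false _     _    = refl
isB-classify false true  _     _    = refl
isB-classify false false true  _    = refl
isB-classify false false false _    = refl

isC-classify : ∀ p q c → (T p → ¬ T c) → (T q → ¬ T c) → isC (classify p q c) ≡ c
isC-classify true  _     true  p⇒¬c _    = ⊥-elim (p⇒¬c _ _)
isC-classify true  _     false _    _    = refl
isC-classify false true  true  _    q⇒¬c = ⊥-elim (q⇒¬c _ _)
isC-classify false true  false _    _    = refl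
isC-classify false false true  _    _    = refl
isC-classify false false false _    _    = refl

∂-edge-identity : ∀ s t → (T (isA s) → ¬ T (isA t)) → (T (isB s) → ¬ T (isB t)) →
                  (T (isC s) → ¬ T (isA t) → ¬ T (isB t) → T (isC t)) →
                  (T (isC t) → ¬ T (isA s) → ¬ T (isB s) → T (isC s)) →
                  𝟙 ((isC s ∨ isA s) xor (isC t ∨ isA t)) + 𝟙 ((isC s ∨ isB s) xor (isC t ∨ isB t))
                    ≡ 𝟙 (isA s ∨ isA t) + 𝟙 (isB s ∨ isB t)
∂-edge-identity shore shore _   _   _  _  = refl
∂-edge-identity shore atA   _   _   _  _  = refl
∂-edge-identity shore atB   _   _   _  _  = refl
∂-edge-identity shore far   _   _   st _  = ⊥-elim (st _ (λ ()) (λ ()))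
∂-edge-identity atA   shore _   _   _  _  = refl
∂-edge-identity atA   atA   ¬aa _   _  _  = ⊥-elim (¬aa _ _)
∂-edge-identity atA   atB   _   _   _  _  = refl
∂-edge-identity atA   far   _   _   _  _  = refl
∂-edge-identity atB   shore _   _   _  _  = refl
∂-edge-identity atB   atA   _   _   _  _  = refl
∂-edge-identity atB   atB   _   ¬bb _  _  = ⊥-elim (¬bb _ _)
∂-edge-identity atB   far   _   _   _  _  = refl
∂-edge-identity far   shore _   _   _  ts = ⊥-elim (ts _ (λ ()) (λ ()))
∂-edge-identity far   atA   _   _   _  _  = refl
∂-edge-identity far   atB   _   _   _  _  = refl
∂-edge-identity far   far   _   _   _  _  = refl

module _ (G : Graph) where
  open Graph G

  Adj? : ∀ x y → Dec (Adj G x y)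
  Adj? x y = any? (λ e → ((src e ≟ x) ×-dec (tgt e ≟ y)) ⊎-dec ((src e ≟ y) ×-dec (tgt e ≟ x)))

  snoc : ∀ {A u x y} → WalkIn G A u x → Adj G x y → A y → WalkIn G A u y
  snoc (nil Ax)         x~y Ay = cons Ax x~y (nil Ay)
  snoc (cons Au u~w wk) x~y Ay = cons Au u~w (snoc wk x~y Ay)

  ClosedOutside : (Fin nV → Bool) → (Fin nV → Set) → Set
  ClosedOutside C Out = ∀ {x y} → T (C x) → Adj G x y → ¬ Out y → T (C y)

  component : ∀ S {u} → u ∉ S →
              ∃ λ C → T (C u) × (∀ {x} → T (C x) → WalkIn G (_∉ S) u x) × ClosedOutside C (_∈ S)
  component S {u} u∉S with closure (λ x y → Adj? x y ×-dec ¬? (y ∈? S)) (WalkIn G (_∉ S) u)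
                             (λ walk (x~y , y∉S) → snoc walk x~y y∉S) (_≡ᵇ u)
                             (λ x≡u → subst (WalkIn G (_∉ S) u) (sym (≡ᵇ⇒≡ x≡u)) (nil u∉S))
  ... | C , u⊆C , C⊆reach , closed =
    C , u⊆C (≡ᵇ-refl u) , C⊆reach , λ x∈C x~y y∉S → closed x∈C (x~y , y∉S)

  ClosedOutside-∖ : ∀ {C S a b} → ClosedOutside C (_∈ S) → (∀ x → x ∈ S → OneOf a b x) →
                    ClosedOutside ((C ∖ a) ∖ b) (OneOf a b)
  ClosedOutside-∖ {C} {a = a} {b} closed S⊆ab {y = y} x∈C′ x~y y∉ab =
    ∈-∖ (C ∖ a) (∈-∖ C y∈C (y∉ab ∘ inj₁)) (y∉ab ∘ inj₂)
    where
    y∈C : T (C y)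
    y∈C = closed (∖-⊆ C (∖-⊆ (C ∖ a) x∈C′)) x~y (y∉ab ∘ S⊆ab _)

  incident : Fin nE → Fin nV → Bool
  incident e x = (src e ≡ᵇ x) ∨ (tgt e ≡ᵇ x)

  lookup-inc : ∀ x e → lookup (inc G x) e ≡ incident e x
  lookup-inc x e = trans (lookup∘tabulate _ e) (cong₂ _∨_ (isYes≗does (src e ≟ x)) (isYes≗does (tgt e ≟ x)))

  degree≡count : ∀ x → degree G x ≡ count (λ e → incident e x)
  degree≡count x = trans (∣p∣≡count (inc G x)) (count-cong (lookup-inc x))

  ∣M∩inc∣≡count : ∀ M x → ∣ M ∩ inc G x ∣ ≡ count (λ e → lookup M e ∧ incident e x)
  ∣M∩inc∣≡count M x = trans (∣p∣≡count (M ∩ inc G x))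
    (count-cong (λ e → trans (lookup-zipWith _∧_ e M (inc G x)) (cong (lookup M e ∧_) (lookup-inc x e))))

  ∣∂∣≡count : ∀ X → ∣ ∂ G (tabulate X) ∣ ≡ count (λ e → X (src e) xor X (tgt e))
  ∣∂∣≡count X = trans (∣tabulate∣≡count (λ e → lookup (tabulate X) (src e) xor lookup (tabulate X) (tgt e)))
    (count-cong (λ e → cong₂ _xor_ (lookup∘tabulate X (src e)) (lookup∘tabulate X (tgt e))))

  -- Double count the pairs (x, e) with x ∈ C, e ∈ M and x an end of e: every x ∈ C is in
  -- exactly one of them, every e ∈ M in none or two, since M-edges do not leave C.
  matching-even : ∀ {D M} → PerfectMatchingWithout G D M → (C : Fin nV → Bool) →
                  (∀ {x} → T (C x) → x ∉ D) → (∀ {e} → e ∈ M → C (src e) ≡ C (tgt e)) →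
                  ∃ λ k → count C ≡ k + k
  matching-even {D} {M} (_ , M-degree) C C∩D≡∅ M-inside = sum g , (begin
    count C                        ≡⟨ sum-cong-≗ row ⟩
    ∑[ x < nV ] ∑[ e < nE ] h x e  ≡⟨ ∑-comm h ⟩
    ∑[ e < nE ] ∑[ x < nV ] h x e  ≡⟨ sum-cong-≗ column ⟩
    ∑[ e < nE ] (g e + g e)        ≡⟨ ∑-distrib-+ g g ⟩
    sum g + sum g                  ∎)
    where
    open ≡-Reasoning
    m : Fin nE → Bool
    m = lookup M
    h : Fin nV → Fin nE → ℕ
    h x e = 𝟙 (C x ∧ (m e ∧ incident e x))
    g : Fin nE → ℕ
    g e = 𝟙 (m e ∧ C (src e))
    row : ∀ x → 𝟙 (C x) ≡ ∑[ e < nE ] 𝟙 (C x ∧ (m e ∧ incident e x))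
    row x with C x in Cx
    ... | false = sym (count-false nE)
    ... | true  = sym (trans (sym (∣M∩inc∣≡count M x)) (M-degree x (C∩D≡∅ (Equivalence.from T-≡ Cx))))
    column : ∀ e → ∑[ x < nV ] 𝟙 (C x ∧ (m e ∧ incident e x))
                   ≡ 𝟙 (m e ∧ C (src e)) + 𝟙 (m e ∧ C (src e))
    column e with m e in me
    ... | false = trans (count-cong (λ x → ∧-zeroʳ (C x))) (count-false nV)
    ... | true  = trans (count-pair C (loopless e))
                        (cong (λ b → 𝟙 (C (src e)) + 𝟙 b) (sym (M-inside (T⇒∈ (Equivalence.from T-≡ me)))))

  ≤2⇒bipartite : nV ≤ 2 → Bipartite G
  ≤2⇒bipartite nV≤2 = isZero , λ e → isZero-separates nV≤2 (loopless e)

  bicritical⇒even : BiCritical G → ∀ {u v} → u ≢ v → ∃ λ k → nV ≡ 2 + (k + k)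
  bicritical⇒even bicritical {u} {v} u≢v = proj₁ rest-even , (begin
      nV                                          ≡⟨ count+count-not uv ⟨
      count uv + count rest                       ≡⟨ cong₂ _+_ ∣uv∣≡2 (proj₂ rest-even) ⟩
      2 + (proj₁ rest-even + proj₁ rest-even)     ∎)
    where
    open ≡-Reasoning
    M-perfect : PerfectMatchingWithout G (⁅ u ⁆ ∪ ⁅ v ⁆) (proj₁ (bicritical u v u≢v))
    M-perfect = proj₂ (bicritical u v u≢v)
    uv rest : Fin nV → Bool
    uv = insert (_≡ᵇ u) v
    rest = not ∘ uv
    ∣uv∣≡2 : count uv ≡ 2
    ∣uv∣≡2 = trans (count-insert (_≡ᵇ u) (≢-sym u≢v ∘ ≡ᵇ⇒≡ {x = v})) (cong suc (count-single u))
    rest∌uv : ∀ {x} → T (rest x) → x ∉ ⁅ u ⁆ ∪ ⁅ v ⁆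
    rest∌uv x∈rest = ¬T-not x∈rest ∘ OneOf⇒T-insert ∘ ∈⁅⁆∪⁅⁆⇒OneOf
    ∉uv⇒rest : ∀ {x} → x ∉ ⁅ u ⁆ ∪ ⁅ v ⁆ → T (rest x)
    ∉uv⇒rest x∉uv = ¬T⇒T-not (x∉uv ∘ OneOf⇒∈⁅⁆∪⁅⁆ ∘ T-insert⇒OneOf)
    M-inside : ∀ {e} → e ∈ proj₁ (bicritical u v u≢v) → rest (src e) ≡ rest (tgt e)
    M-inside {e} e∈M with s∉uv , t∉uv ← proj₁ M-perfect e e∈M =
      T⇔T⇒≡ (λ _ → ∉uv⇒rest t∉uv) (λ _ → ∉uv⇒rest s∉uv)
    rest-even : ∃ λ k → count rest ≡ k + k
    rest-even = matching-even M-perfect rest rest∌uv M-inside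

  4≤nV : ¬ Bipartite G → BiCritical G → 4 ≤ nV
  4≤nV non-bipartite bicritical with nV ≤? 2
  ... | yes nV≤2 = ⊥-elim (non-bipartite (≤2⇒bipartite nV≤2))
  ... | no  nV≰2 with two-distinct (≤-trans (s≤s (s≤s z≤n)) (≰⇒> nV≰2))
  ... | _ , _ , u≢v with bicritical⇒even bicritical u≢v
  ... | k , nV≡2+2k =
    subst (4 ≤_) (sym nV≡2+2k) (3≤2+2k⇒4≤ k (subst (3 ≤_) nV≡2+2k (≰⇒> nV≰2)))

  ∣∂∣+∣∂∣≡degree+degree : ∀ {a b} → a ≢ b → (C : Fin nV → Bool) → ¬ T (C a) → ¬ T (C b) →
    ClosedOutside C (OneOf a b) →
    ∣ ∂ G (tabulate (insert C a)) ∣ + ∣ ∂ G (tabulate (insert C b)) ∣ ≡ degree G a + degree G b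
  ∣∂∣+∣∂∣≡degree+degree {a} {b} a≢b C a∉C b∉C closed = begin
    ∣ ∂ G (tabulate Xa) ∣ + ∣ ∂ G (tabulate Xb) ∣
      ≡⟨ cong₂ _+_ (∣∂∣≡count Xa) (∣∂∣≡count Xb) ⟩
    count (crosses Xa) + count (crosses Xb)
      ≡⟨ ∑-distrib-+ (𝟙 ∘ crosses Xa) (𝟙 ∘ crosses Xb) ⟨
    ∑[ e < nE ] (𝟙 (crosses Xa e) + 𝟙 (crosses Xb e))
      ≡⟨ sum-cong-≗ edge ⟩
    ∑[ e < nE ] (𝟙 (incident e a) + 𝟙 (incident e b))
      ≡⟨ ∑-distrib-+ (λ e → 𝟙 (incident e a)) _ ⟩
    count (λ e → incident e a) + count (λ e → incident e b)
      ≡⟨ cong₂ _+_ (degree≡count a) (degree≡count b) ⟨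
    degree G a + degree G b
      ∎
    where
    open ≡-Reasoning
    Xa Xb : Fin nV → Bool
    Xa = insert C a
    Xb = insert C b
    crosses : (Fin nV → Bool) → Fin nE → Bool
    crosses X e = X (src e) xor X (tgt e)

    side : Fin nV → Side
    side x = classify (x ≡ᵇ a) (x ≡ᵇ b) (C x)
    isA-side : ∀ x → isA (side x) ≡ x ≡ᵇ a
    isA-side x = isA-classify (x ≡ᵇ a) (x ≡ᵇ b) (C x)
    isB-side : ∀ x → isB (side x) ≡ x ≡ᵇ b
    isB-side x = isB-classify (x ≡ᵇ a) (x ≡ᵇ b) (C x)
      (λ x≡a x≡b → a≢b (trans (sym (≡ᵇ⇒≡ {x = x} x≡a)) (≡ᵇ⇒≡ {x = x} x≡b)))
    isC-side : ∀ x → isC (side x) ≡ C x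
    isC-side x = isC-classify (x ≡ᵇ a) (x ≡ᵇ b) (C x)
      (λ x≡a → a∉C ∘ subst (T ∘ C) (≡ᵇ⇒≡ {x = x} x≡a))
      (λ x≡b → b∉C ∘ subst (T ∘ C) (≡ᵇ⇒≡ {x = x} x≡b))

    no-loop : ∀ {v} (is : Side → Bool) → (∀ x → is (side x) ≡ x ≡ᵇ v) →
              ∀ e → T (is (side (src e))) → ¬ T (is (side (tgt e)))
    no-loop is is-side e p q =
      loopless e (trans (≡ᵇ⇒≡ {x = src e} (subst T (is-side _) p))
                        (sym (≡ᵇ⇒≡ {x = tgt e} (subst T (is-side _) q))))

    stays : ∀ {x y} → Adj G x y → T (isC (side x)) → ¬ T (isA (side y)) → ¬ T (isB (side y)) → T (isC (side y))
    stays {x} {y} x~y Cx y≢a y≢b = subst T (sym (isC-side y)) (closed (subst T (isC-side x) Cx) x~y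
      (¬OneOf (y≢a ∘ subst T (sym (isA-side y)) ∘ ≡⇒≡ᵇ) (y≢b ∘ subst T (sym (isB-side y)) ∘ ≡⇒≡ᵇ)))

    edge : ∀ e → 𝟙 (crosses Xa e) + 𝟙 (crosses Xb e) ≡ 𝟙 (incident e a) + 𝟙 (incident e b)
    edge e = begin
      𝟙 (crosses Xa e) + 𝟙 (crosses Xb e)
        ≡⟨ cong₂ _+_ (cong 𝟙 (cong₂ _xor_ (X-side {is = isA} isA-side (src e)) (X-side {is = isA} isA-side (tgt e))))
                     (cong 𝟙 (cong₂ _xor_ (X-side {is = isB} isB-side (src e)) (X-side {is = isB} isB-side (tgt e)))) ⟨
      𝟙 ((isC s ∨ isA s) xor (isC t ∨ isA t)) + 𝟙 ((isC s ∨ isB s) xor (isC t ∨ isB t))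
        ≡⟨ ∂-edge-identity s t (no-loop isA isA-side e) (no-loop isB isB-side e)
                               (stays (e , inj₁ (refl , refl))) (stays (e , inj₂ (refl , refl))) ⟩
      𝟙 (isA s ∨ isA t) + 𝟙 (isB s ∨ isB t)
        ≡⟨ cong₂ _+_ (cong 𝟙 (cong₂ _∨_ (isA-side (src e)) (isA-side (tgt e))))
                     (cong 𝟙 (cong₂ _∨_ (isB-side (src e)) (isB-side (tgt e)))) ⟩
      𝟙 (incident e a) + 𝟙 (incident e b) ∎
      where
      s t : Side
      s = side (src e)
      t = side (tgt e)
      X-side : ∀ {v} {is : Side → Bool} → (∀ x → is (side x) ≡ x ≡ᵇ v) →
               ∀ x → isC (side x) ∨ is (side x) ≡ insert C v x
      X-side is-side x = cong₂ _∨_ (isC-side x) (is-side x)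

module _ (G : Graph) {r : ℕ} (r-graph : IsRGraph G r) (bicritical : BiCritical G)
         (no-tight-cut : ∀ X → OddSet G X → ∣ X ∣ ≢ 1 → ∣ X ∣ ≢ Graph.nV G ∸ 1 → ∣ ∂ G X ∣ ≢ r) where
  open Graph G

  no-separating-pair : ∀ {a b} → a ≢ b → (C : Fin nV → Bool) → ¬ T (C a) → ¬ T (C b) →
                       ClosedOutside G C (OneOf a b) →
                       ∀ {u v} → T (C u) → ¬ T (C v) → ¬ OneOf a b v → ⊥
  no-separating-pair {a} {b} a≢b C a∉C b∉C closed {u} {v} u∈C v∉C v∉ab =
    no-tight-cut (X a) (odd a∉C) ∣Xa∣≢1 ∣Xa∣≢nV∸1 ∣∂Xa∣≡r
    where
    X : Fin nV → Subset nV
    X c = tabulate (insert C c)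

    M-inside : ∀ {e} → e ∈ proj₁ (bicritical a b a≢b) → C (src e) ≡ C (tgt e)
    M-inside {e} e∈M = T⇔T⇒≡ (λ Cs → closed Cs (e , inj₁ (refl , refl)) (t∉ab ∘ OneOf⇒∈⁅⁆∪⁅⁆))
                              (λ Ct → closed Ct (e , inj₂ (refl , refl)) (s∉ab ∘ OneOf⇒∈⁅⁆∪⁅⁆))
      where
      s∉ab : src e ∉ ⁅ a ⁆ ∪ ⁅ b ⁆
      s∉ab = proj₁ (proj₁ (proj₂ (bicritical a b a≢b)) e e∈M)
      t∉ab : tgt e ∉ ⁅ a ⁆ ∪ ⁅ b ⁆
      t∉ab = proj₂ (proj₁ (proj₂ (bicritical a b a≢b)) e e∈M)

    C-even : ∃ λ k → count C ≡ k + k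
    C-even = matching-even G (proj₂ (bicritical a b a≢b)) C
               (λ x∈C → C∌ab x∈C ∘ ∈⁅⁆∪⁅⁆⇒OneOf) M-inside
      where
      C∌ab : ∀ {x} → T (C x) → ¬ OneOf a b x
      C∌ab x∈C (inj₁ refl) = a∉C x∈C
      C∌ab x∈C (inj₂ refl) = b∉C x∈C

    ∣X∣ : ∀ {c} → ¬ T (C c) → ∣ X c ∣ ≡ suc (count C)
    ∣X∣ {c} c∉C = trans (∣tabulate∣≡count (insert C c)) (count-insert C c∉C)

    odd : ∀ {c} → ¬ T (C c) → OddSet G (X c)
    odd c∉C with k , ∣C∣≡2k ← C-even =
      trans (cong (_% 2) (trans (∣X∣ c∉C) (cong suc ∣C∣≡2k))) (suc-double%2 k)

    ∣∂Xa∣≡r : ∣ ∂ G (X a) ∣ ≡ r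
    ∣∂Xa∣≡r = ≤-antisym
      (+-cancelʳ-≤ r _ r (≤-trans (+-monoʳ-≤ _ (proj₂ r-graph (X b) (odd b∉C))) (≤-reflexive ∂-sum)))
      (proj₂ r-graph (X a) (odd a∉C))
      where
      ∂-sum : ∣ ∂ G (X a) ∣ + ∣ ∂ G (X b) ∣ ≡ r + r
      ∂-sum = trans (∣∂∣+∣∂∣≡degree+degree G a≢b C a∉C b∉C closed)
                    (cong₂ _+_ (proj₁ r-graph a) (proj₁ r-graph b))

    ∣Xa∣≢1 : ∣ X a ∣ ≢ 1
    ∣Xa∣≢1 ∣Xa∣≡1 =
      1+n≰n (subst (1 ≤_) (suc-injective (trans (sym (∣X∣ a∉C)) ∣Xa∣≡1)) (1≤count C u∈C))

    ∣Xa∣≢nV∸1 : ∣ X a ∣ ≢ nV ∸ 1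
    ∣Xa∣≢nV∸1 ∣Xa∣≡nV∸1 = pred+2≰ nV (begin
      (nV ∸ 1) + 2
        ≡⟨ cong (_+ 2) ∣Xa∣≡nV∸1 ⟨
      ∣ X a ∣ + 2
        ≤⟨ +-monoʳ-≤ ∣ X a ∣ outside≥2 ⟩
      ∣ X a ∣ + count (not ∘ insert C a)
        ≡⟨ cong (_+ count (not ∘ insert C a)) (∣tabulate∣≡count (insert C a)) ⟩
      count (insert C a) + count (not ∘ insert C a)
        ≡⟨ count+count-not (insert C a) ⟩
      nV ∎)
      where
      open ≤-Reasoning
      outside≥2 : 2 ≤ count (not ∘ insert C a)
      outside≥2 = 2≤count (not ∘ insert C a) (∉-insert C v∉C (v∉ab ∘ inj₁)) (∉-insert C b∉C (≢-sym a≢b))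
                          (v∉ab ∘ inj₂)

  connected-without : 4 ≤ nV → ∀ S → ∣ S ∣ < 3 → ConnectedWithout G S
  connected-without 4≤nV S ∣S∣<3 u v u∉S v∉S with component G S u∉S
  ... | C , u∈C , C⊆reach , closed with T? (C v)
  ...   | yes v∈C = C⊆reach v∈C
  ...   | no  v∉C with pair-cover 4≤nV S ∣S∣<3 u∉S v∉S
  ...     | a , b , a≢b , S⊆ab , u∉ab , v∉ab =
    ⊥-elim (no-separating-pair a≢b ((C ∖ a) ∖ b) (∉-∖ C a ∘ ∖-⊆ (C ∖ a)) (∉-∖ (C ∖ a) b)
      (ClosedOutside-∖ G closed S⊆ab)
      (∈-∖ (C ∖ a) (∈-∖ C u∈C (u∉ab ∘ inj₁)) (u∉ab ∘ inj₂))
      (v∉C ∘ ∖-⊆ C ∘ ∖-⊆ (C ∖ a)) v∉ab)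

theorem3 : (r : ℕ) → r ≥ 1 → (G : Graph) → Connected G →
    IsRGraph G r → BiCritical G → ¬ Bipartite G →
    (∀ X → OddSet G X → ∣ X ∣ ≢ 1 → ∣ X ∣ ≢ Graph.nV G ∸ 1 → ∣ ∂ G X ∣ ≢ r) →
    Brick G
theorem3 r _ G _ r-graph bicritical non-bipartite no-tight-cut =
  non-bipartite , bicritical , 4≤n , connected-without G r-graph bicritical no-tight-cut 4≤n
  where
  4≤n : 4 ≤ Graph.nV G
  4≤n = 4≤nV G non-bipartite bicritical
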